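{- Let $f_1,f_2,f_3,f_4\in\mathbb{C}[x,y]$ be pairwise non-proportional binary quadratic forms with $f_1^3+f_2^3=f_3^3+f_4^3$, and suppose this identity is of Type$(T)$. Then $T(T^3-1)\neq0$.
   Context: An identity $g_1^3+g_2^3=g_3^3+g_4^3$ among pairwise non-proportional binary quadratic forms is of Type$(T)$ if, perhaps after replacing it by one of its flips ($g_1^3-g_3^3=-g_2^3+g_4^3$ or $g_1^3-g_4^3=-g_2^3+g_3^3$, relabeled so as to read $h_1^3+h_2^3=h_3^3+h_4^3$ with each $h_j\in\{\pm g_k\}$), one has $h_1^3+h_2^3=h_3^3+h_4^3$ and $h_1+h_2=T(h_3+h_4)$. -}

module Defs where

open import Level using (_⊔_)
open import Algebra.Bundles using (CommutativeRing)
open import Data.Nat using (ℕ; zero; suc)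
open import Data.List using (List; []; _∷_; map; _++_; [_])
open import Data.List.Relation.Binary.Pointwise using (Pointwise)
open import Data.Product using (_×_; _,_; ∃; ∃-syntax)
open import Data.Sum using (_⊎_)
open import Relation.Nullary using (¬_)

-- Everything below is relative to a commutative ring R; the theorem instantiates
-- R with an algebraically closed field of characteristic zero (stand-in for ℂ).
module Forms {c ℓ} (R : CommutativeRing c ℓ) where
  open CommutativeRing R

  ι : ℕ → Carrier
  ι zero    = 0#
  ι (suc n) = 1# + ι n

  eval : List Carrier → Carrier → Carrier
  eval []       t = 0#
  eval (a ∷ as) t = a + t * eval as t

  -- Binary forms: a homogeneous form of degree d in x, y is represented by
  -- its coefficient list [c₀, …, c_d], c_i being the coefficient of x^(d-i) y^i.

  addL : List Carrier → List Carrier → List Carrier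
  addL []       q        = q
  addL (a ∷ p)  []       = a ∷ p
  addL (a ∷ p)  (b ∷ q)  = (a + b) ∷ addL p q

  mulL : List Carrier → List Carrier → List Carrier
  mulL []      q = []
  mulL (a ∷ p) q = addL (map (a *_) q) (0# ∷ mulL p q)

  _≋_ : List Carrier → List Carrier → Set (c ⊔ ℓ)
  _≋_ = Pointwise _≈_

  record QForm : Set c where
    constructor qf
    field
      a b c' : Carrier

  coeffs : QForm → List Carrier
  coeffs (qf a b c') = a ∷ b ∷ c' ∷ []

  _⊕_ : QForm → QForm → QForm
  qf a b c' ⊕ qf a₁ b₁ c₁ = qf (a + a₁) (b + b₁) (c' + c₁)

  _·_ : Carrier → QForm → QForm
  λ₀ · qf a b c' = qf (λ₀ * a) (λ₀ * b) (λ₀ * c')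

  ⊝_ : QForm → QForm
  ⊝ (qf a b c') = qf (- a) (- b) (- c')

  _≐_ : QForm → QForm → Set ℓ
  qf a b c' ≐ qf a₁ b₁ c₁ = (a ≈ a₁) × (b ≈ b₁) × (c' ≈ c₁)

  cube : QForm → List Carrier
  cube f = mulL (coeffs f) (mulL (coeffs f) (coeffs f))

  CubeId : QForm → QForm → QForm → QForm → Set (c ⊔ ℓ)
  CubeId f₁ f₂ f₃ f₄ = addL (cube f₁) (cube f₂) ≋ addL (cube f₃) (cube f₄)

  Proportional : QForm → QForm → Set (c ⊔ ℓ)
  Proportional f g = (∃[ λ₀ ] f ≐ (λ₀ · g)) ⊎ (∃[ λ₀ ] g ≐ (λ₀ · f))

  PairwiseNonProp : QForm → QForm → QForm → QForm → Set (c ⊔ ℓ)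
  PairwiseNonProp f₁ f₂ f₃ f₄ =
    ¬ Proportional f₁ f₂ × ¬ Proportional f₁ f₃ × ¬ Proportional f₁ f₄ ×
    ¬ Proportional f₂ f₃ × ¬ Proportional f₂ f₄ × ¬ Proportional f₃ f₄

  TypeCond : Carrier → QForm → QForm → QForm → QForm → Set (c ⊔ ℓ)
  TypeCond T h₁ h₂ h₃ h₄ = CubeId h₁ h₂ h₃ h₄ × ((h₁ ⊕ h₂) ≐ (T · (h₃ ⊕ h₄)))

  IsOfType : Carrier → QForm → QForm → QForm → QForm → Set (c ⊔ ℓ)
  IsOfType T g₁ g₂ g₃ g₄ =
    TypeCond T g₁ g₂ g₃ g₄
    ⊎ TypeCond T g₁ (⊝ g₃) (⊝ g₂) g₄
    ⊎ TypeCond T g₁ (⊝ g₄) (⊝ g₂) g₃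

record ACField0 c ℓ : Set (Level.suc (c ⊔ ℓ)) where
  field
    cring : CommutativeRing c ℓ
  open CommutativeRing cring
  open Forms cring using (ι; eval)
  field
    nontrivial : ¬ (1# ≈ 0#)
    inverse    : ∀ x → ¬ (x ≈ 0#) → ∃[ y ] (x * y ≈ 1#)
    char0      : ∀ n → ¬ (ι (suc n) ≈ 0#)
    -- every monic polynomial a₀ + a₁ t + … + t^(n+1) of positive degree has a root
    algClosed  : ∀ a as → ∃[ t ] (eval ((a ∷ as) ++ [ 1# ]) t ≈ 0#)

module Submission where

-- Write h₁³ + h₂³ = h₃³ + h₄³ with h₁ + h₂ = T s, s = h₃ + h₄, for the flip
-- realising Type(T).  If T = 0 then h₂ = -h₁.  If T³ = 1, expanding cubes of
-- sums gives 3 s (T h₁ h₂ - h₃ h₄) = 0, so T h₁ h₂ = h₃ h₄ (as s ≠ 0, else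
-- h₃ = -h₄), and then T²h₁ is a root of (X - h₃)(X - h₄), forcing h₃ or h₄
-- to be proportional to h₁.

open import Defs
open import Algebra.Bundles using (CommutativeRing)
open import Relation.Nullary using (¬_)
open import Data.Nat using (ℕ; zero; suc)
open import Data.List using (List; []; _∷_; map)
open import Data.List.Relation.Binary.Pointwise using (Pointwise; []; _∷_)
open import Data.Product using (_,_; ∃-syntax)
open import Data.Sum using (inj₁; inj₂)
open import Function using (_∘_)
open import Level using (_⊔_)
open import Relation.Nullary.Decidable using (yes; no; ¬¬-excluded-middle)

-- Univariate polynomials (equivalently, binary forms of any degree) as the
-- coefficient lists of Defs, with addL and mulL as sum and product.
module Polynomials {c ℓ} (R : CommutativeRing c ℓ) where
  open CommutativeRing R
  open Forms R using (addL; mulL; ι)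
  open import Relation.Binary.Reasoning.Setoid setoid
  open import Algebra.Properties.CommutativeSemigroup +-commutativeSemigroup
    using (x∙yz≈y∙xz; interchange)
  open import Algebra.Properties.Ring ring using (-0#≈0#)

  coeff : List Carrier → ℕ → Carrier
  coeff []      n       = 0#
  coeff (a ∷ p) zero    = a
  coeff (a ∷ p) (suc n) = coeff p n

  -- Equality of polynomials: equal coefficients, so trailing zeros are irrelevant.
  infix 4 _≃_
  record _≃_ (p q : List Carrier) : Set ℓ where
    constructor coeffwise
    field at : ∀ n → coeff p n ≈ coeff q n
  open _≃_ public

  ≃-refl : ∀ {p} → p ≃ p
  ≃-refl = coeffwise λ n → refl

  ≃-sym : ∀ {p q} → p ≃ q → q ≃ p
  ≃-sym p≃q = coeffwise λ n → sym (p≃q .at n)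

  ≃-trans : ∀ {p q r} → p ≃ q → q ≃ r → p ≃ r
  ≃-trans p≃q q≃r = coeffwise λ n → trans (p≃q .at n) (q≃r .at n)

  ∷-cong : ∀ {a b p q} → a ≈ b → p ≃ q → (a ∷ p) ≃ (b ∷ q)
  ∷-cong a≈b p≃q = coeffwise λ where
    zero    → a≈b
    (suc n) → p≃q .at n

  0∷[]≃[] : (0# ∷ []) ≃ []
  0∷[]≃[] = coeffwise λ where
    zero    → refl
    (suc n) → refl

  coeff-addL : ∀ p q n → coeff (addL p q) n ≈ coeff p n + coeff q n
  coeff-addL []      q       n       = sym (+-identityˡ _)
  coeff-addL (a ∷ p) []      n       = sym (+-identityʳ _)
  coeff-addL (a ∷ p) (b ∷ q) zero    = refl
  coeff-addL (a ∷ p) (b ∷ q) (suc n) = coeff-addL p q n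

  coeff-neg : ∀ p n → coeff (map -_ p) n ≈ - coeff p n
  coeff-neg []      n       = sym -0#≈0#
  coeff-neg (a ∷ p) zero    = refl
  coeff-neg (a ∷ p) (suc n) = coeff-neg p n

  coeff-scale : ∀ a p n → coeff (map (a *_) p) n ≈ a * coeff p n
  coeff-scale a []      n       = sym (zeroʳ a)
  coeff-scale a (b ∷ p) zero    = refl
  coeff-scale a (b ∷ p) (suc n) = coeff-scale a p n

  coeff-mulL : ∀ a p q n → coeff (mulL (a ∷ p) q) n ≈ a * coeff q n + coeff (0# ∷ mulL p q) n
  coeff-mulL a p q n =
    trans (coeff-addL (map (a *_) q) (0# ∷ mulL p q) n) (+-congʳ (coeff-scale a q n))

  addL-cong : ∀ {p p′ q q′} → p ≃ p′ → q ≃ q′ → addL p q ≃ addL p′ q′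
  addL-cong {p} {p′} {q} {q′} p≃p′ q≃q′ = coeffwise λ n → begin
    coeff (addL p q) n         ≈⟨ coeff-addL p q n ⟩
    coeff p n + coeff q n      ≈⟨ +-cong (p≃p′ .at n) (q≃q′ .at n) ⟩
    coeff p′ n + coeff q′ n    ≈⟨ coeff-addL p′ q′ n ⟨
    coeff (addL p′ q′) n       ∎

  addL-assoc : ∀ p q r → addL (addL p q) r ≃ addL p (addL q r)
  addL-assoc p q r = coeffwise λ n → begin
    coeff (addL (addL p q) r) n            ≈⟨ coeff-addL (addL p q) r n ⟩
    coeff (addL p q) n + coeff r n         ≈⟨ +-congʳ (coeff-addL p q n) ⟩
    (coeff p n + coeff q n) + coeff r n    ≈⟨ +-assoc _ _ _ ⟩
    coeff p n + (coeff q n + coeff r n)    ≈⟨ +-congˡ (coeff-addL q r n) ⟨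
    coeff p n + coeff (addL q r) n         ≈⟨ coeff-addL p (addL q r) n ⟨
    coeff (addL p (addL q r)) n            ∎

  addL-comm : ∀ p q → addL p q ≃ addL q p
  addL-comm p q = coeffwise λ n → begin
    coeff (addL p q) n      ≈⟨ coeff-addL p q n ⟩
    coeff p n + coeff q n   ≈⟨ +-comm _ _ ⟩
    coeff q n + coeff p n   ≈⟨ coeff-addL q p n ⟨
    coeff (addL q p) n      ∎

  addL-identityʳ : ∀ p → addL p [] ≃ p
  addL-identityʳ p = coeffwise λ n → trans (coeff-addL p [] n) (+-identityʳ _)

  neg-inverseˡ : ∀ p → addL (map -_ p) p ≃ []
  neg-inverseˡ p = coeffwise λ n →
    trans (coeff-addL (map -_ p) p n) (trans (+-congʳ (coeff-neg p n)) (-‿inverseˡ _))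

  neg-inverseʳ : ∀ p → addL p (map -_ p) ≃ []
  neg-inverseʳ p = ≃-trans (addL-comm p (map -_ p)) (neg-inverseˡ p)

  neg-cong : ∀ {p q} → p ≃ q → map -_ p ≃ map -_ q
  neg-cong {p} {q} p≃q = coeffwise λ n →
    trans (coeff-neg p n) (trans (-‿cong (p≃q .at n)) (sym (coeff-neg q n)))

  mulL-congʳ : ∀ p {q q′} → q ≃ q′ → mulL p q ≃ mulL p q′
  mulL-congʳ []      q≃q′ = ≃-refl
  mulL-congʳ (a ∷ p) {q} {q′} q≃q′ = coeffwise λ n → begin
    coeff (mulL (a ∷ p) q) n                        ≈⟨ coeff-mulL a p q n ⟩
    a * coeff q n + coeff (0# ∷ mulL p q) n          ≈⟨ +-cong (*-congˡ (q≃q′ .at n))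
                                                               (∷-cong refl (mulL-congʳ p q≃q′) .at n) ⟩
    a * coeff q′ n + coeff (0# ∷ mulL p q′) n        ≈⟨ coeff-mulL a p q′ n ⟨
    coeff (mulL (a ∷ p) q′) n                       ∎

  -- The right-hand counterparts of the defining equations of mulL, from which
  -- commutativity follows by induction on the first factor.
  mulL-zeroʳ : ∀ p → mulL p [] ≃ []
  mulL-zeroʳ []      = ≃-refl
  mulL-zeroʳ (a ∷ p) = coeffwise λ n → begin
    coeff (mulL (a ∷ p) []) n                  ≈⟨ coeff-mulL a p [] n ⟩
    a * 0# + coeff (0# ∷ mulL p []) n          ≈⟨ +-cong (zeroʳ a)
                                                         (≃-trans (∷-cong refl (mulL-zeroʳ p)) 0∷[]≃[] .at n) ⟩
    0# + 0#                                    ≈⟨ +-identityʳ 0# ⟩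
    0#                                         ∎

  mulL-consʳ : ∀ p b q → mulL p (b ∷ q) ≃ addL (map (b *_) p) (0# ∷ mulL p q)
  mulL-consʳ []      b q = coeffwise λ where
    zero    → refl
    (suc n) → refl
  mulL-consʳ (a ∷ p) b q = coeffwise λ where
    zero    → +-congʳ (*-comm a b)
    (suc n) → begin
        coeff (addL (map (a *_) q) (mulL p (b ∷ q))) n
          ≈⟨ coeff-addL (map (a *_) q) (mulL p (b ∷ q)) n ⟩
        coeff (map (a *_) q) n + coeff (mulL p (b ∷ q)) n
          ≈⟨ +-cong (coeff-scale a q n) (mulL-consʳ p b q .at n) ⟩
        a * coeff q n + coeff (addL (map (b *_) p) (0# ∷ mulL p q)) n
          ≈⟨ +-congˡ (coeff-addL (map (b *_) p) (0# ∷ mulL p q) n) ⟩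
        a * coeff q n + (coeff (map (b *_) p) n + coeff (0# ∷ mulL p q) n)
          ≈⟨ x∙yz≈y∙xz _ _ _ ⟩
        coeff (map (b *_) p) n + (a * coeff q n + coeff (0# ∷ mulL p q) n)
          ≈⟨ +-congˡ (coeff-mulL a p q n) ⟨
        coeff (map (b *_) p) n + coeff (mulL (a ∷ p) q) n
          ≈⟨ coeff-addL (map (b *_) p) (mulL (a ∷ p) q) n ⟨
        coeff (addL (map (b *_) p) (mulL (a ∷ p) q)) n
          ∎

  mulL-comm : ∀ p q → mulL p q ≃ mulL q p
  mulL-comm []      q = ≃-sym (mulL-zeroʳ q)
  mulL-comm (a ∷ p) q =
    ≃-trans (addL-cong ≃-refl (∷-cong refl (mulL-comm p q))) (≃-sym (mulL-consʳ q a p))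

  mulL-cong : ∀ {p p′ q q′} → p ≃ p′ → q ≃ q′ → mulL p q ≃ mulL p′ q′
  mulL-cong {p} {p′} {q} {q′} p≃p′ q≃q′ =
    ≃-trans (mulL-congʳ p q≃q′)
      (≃-trans (mulL-comm p q′) (≃-trans (mulL-congʳ q′ p≃p′) (mulL-comm q′ p′)))

  -- Multiplication distributes over addition; by commutativity only the
  -- first argument needs an induction.
  mulL-distribʳ : ∀ p p′ q → mulL (addL p p′) q ≃ addL (mulL p q) (mulL p′ q)
  mulL-distribʳ []      p′       q = ≃-refl
  mulL-distribʳ (a ∷ p) []       q = ≃-sym (addL-identityʳ (mulL (a ∷ p) q))
  mulL-distribʳ (a ∷ p) (a′ ∷ p′) q = coeffwise λ n → begin
    coeff (mulL ((a + a′) ∷ addL p p′) q) n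
      ≈⟨ coeff-mulL (a + a′) (addL p p′) q n ⟩
    (a + a′) * coeff q n + coeff (0# ∷ mulL (addL p p′) q) n
      ≈⟨ +-cong (distribʳ _ a a′)
                (∷-cong (sym (+-identityʳ 0#)) (mulL-distribʳ p p′ q) .at n) ⟩
    (a * coeff q n + a′ * coeff q n) + coeff (addL (0# ∷ mulL p q) (0# ∷ mulL p′ q)) n
      ≈⟨ +-congˡ (coeff-addL (0# ∷ mulL p q) (0# ∷ mulL p′ q) n) ⟩
    (a * coeff q n + a′ * coeff q n) + (coeff (0# ∷ mulL p q) n + coeff (0# ∷ mulL p′ q) n)
      ≈⟨ interchange _ _ _ _ ⟩
    (a * coeff q n + coeff (0# ∷ mulL p q) n) + (a′ * coeff q n + coeff (0# ∷ mulL p′ q) n)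
      ≈⟨ +-cong (coeff-mulL a p q n) (coeff-mulL a′ p′ q n) ⟨
    coeff (mulL (a ∷ p) q) n + coeff (mulL (a′ ∷ p′) q) n
      ≈⟨ coeff-addL (mulL (a ∷ p) q) (mulL (a′ ∷ p′) q) n ⟨
    coeff (addL (mulL (a ∷ p) q) (mulL (a′ ∷ p′) q)) n
      ∎

  mulL-distribˡ : ∀ p q q′ → mulL p (addL q q′) ≃ addL (mulL p q) (mulL p q′)
  mulL-distribˡ p q q′ =
    ≃-trans (mulL-comm p (addL q q′))
      (≃-trans (mulL-distribʳ q q′ p) (addL-cong (mulL-comm q p) (mulL-comm q′ p)))

  -- Multiplication commutes with the shift p ↦ y p and with scalars; these are
  -- the two pieces of the defining recursion needed for associativity.
  mulL-shiftˡ : ∀ p q → mulL (0# ∷ p) q ≃ (0# ∷ mulL p q)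
  mulL-shiftˡ p q = coeffwise λ n →
    trans (coeff-mulL 0# p q n) (trans (+-congʳ (zeroˡ _)) (+-identityˡ _))

  mulL-scaleˡ : ∀ a q r → mulL (map (a *_) q) r ≃ map (a *_) (mulL q r)
  mulL-scaleˡ a []      r   = ≃-refl
  mulL-scaleˡ a (b ∷ q) r = coeffwise λ n → begin
    coeff (mulL (a * b ∷ map (a *_) q) r) n
      ≈⟨ coeff-mulL (a * b) (map (a *_) q) r n ⟩
    (a * b) * coeff r n + coeff (0# ∷ mulL (map (a *_) q) r) n
      ≈⟨ +-cong (*-assoc a b _) (∷-cong (sym (zeroʳ a)) (mulL-scaleˡ a q r) .at n) ⟩
    a * (b * coeff r n) + coeff (map (a *_) (0# ∷ mulL q r)) n
      ≈⟨ +-congˡ (coeff-scale a (0# ∷ mulL q r) n) ⟩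
    a * (b * coeff r n) + a * coeff (0# ∷ mulL q r) n
      ≈⟨ distribˡ a _ _ ⟨
    a * (b * coeff r n + coeff (0# ∷ mulL q r) n)
      ≈⟨ *-congˡ (coeff-mulL b q r n) ⟨
    a * coeff (mulL (b ∷ q) r) n
      ≈⟨ coeff-scale a (mulL (b ∷ q) r) n ⟨
    coeff (map (a *_) (mulL (b ∷ q) r)) n
      ∎

  mulL-assoc : ∀ p q r → mulL (mulL p q) r ≃ mulL p (mulL q r)
  mulL-assoc []      q r = ≃-refl
  mulL-assoc (a ∷ p) q r =
    ≃-trans (mulL-distribʳ (map (a *_) q) (0# ∷ mulL p q) r)
      (addL-cong (mulL-scaleˡ a q r)
                 (≃-trans (mulL-shiftˡ (mulL p q) r) (∷-cong refl (mulL-assoc p q r))))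

  mulL-identityˡ : ∀ q → mulL (1# ∷ []) q ≃ q
  mulL-identityˡ q = coeffwise λ n →
    trans (coeff-mulL 1# [] q n) (trans (+-cong (*-identityˡ _) (0∷[]≃[] .at n)) (+-identityʳ _))

  polyRing : CommutativeRing c ℓ
  polyRing = record
    { Carrier           = List Carrier
    ; _≈_               = _≃_
    ; _+_               = addL
    ; _*_               = mulL
    ; -_                = map (-_)
    ; 0#                = []
    ; 1#                = 1# ∷ []
    ; isCommutativeRing = record
      { isRing = record
        { +-isAbelianGroup = record
          { isGroup = record
            { isMonoid = record
              { isSemigroup = record
                { isMagma = record
                  { isEquivalence = record { refl = ≃-refl ; sym = ≃-sym ; trans = ≃-trans }
                  ; ∙-cong        = addL-cong
                  }
                ; assoc = addL-assoc
                }
              ; identity = (λ p → ≃-refl) , addL-identityʳ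
              }
            ; inverse = neg-inverseˡ , neg-inverseʳ
            ; ⁻¹-cong = neg-cong
            }
          ; comm = addL-comm
          }
        ; *-cong     = mulL-cong
        ; *-assoc    = mulL-assoc
        ; *-identity = mulL-identityˡ , λ p → ≃-trans (mulL-comm p (1# ∷ [])) (mulL-identityˡ p)
        ; distrib    = mulL-distribˡ , λ q p p′ → mulL-distribʳ p p′ q
        }
      ; *-comm = mulL-comm
      }
    }

  const : Carrier → List Carrier
  const a = a ∷ []

  coeff-constMul : ∀ a q n → coeff (mulL (const a) q) n ≈ a * coeff q n
  coeff-constMul a q n =
    trans (coeff-mulL a [] q n) (trans (+-congˡ (0∷[]≃[] .at n)) (+-identityʳ _))

  const-cong : ∀ {a b} → a ≈ b → const a ≃ const b
  const-cong a≈b = ∷-cong a≈b ≃-refl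

  const-* : ∀ a b → const (a * b) ≃ mulL (const a) (const b)
  const-* a b = coeffwise λ where
    zero    → sym (coeff-constMul a (const b) 0)
    (suc n) → sym (trans (coeff-constMul a (const b) (suc n)) (zeroʳ a))

  ι-const : ∀ n → Forms.ι polyRing n ≃ const (ι n)
  ι-const zero    = ≃-sym 0∷[]≃[]
  ι-const (suc n) = addL-cong ≃-refl (ι-const n)

  constMul-cancel : ∀ {a p q} → (∀ {x y} → a * x ≈ a * y → x ≈ y) →
                    mulL (const a) p ≃ mulL (const a) q → p ≃ q
  constMul-cancel {a} {p} {q} cancel ap≃aq = coeffwise λ n →
    cancel (trans (sym (coeff-constMul a p n)) (trans (ap≃aq .at n) (coeff-constMul a q n)))

  -- Over a ring without zero divisors the polynomial ring has none either:
  -- strip vanishing lowest coefficients until both are nonzero; their product is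
  -- then the nonzero lowest coefficient of the product.
  module NoZeroDivisors (noZeroDivisors : ∀ {x y} → ¬ x ≈ 0# → ¬ y ≈ 0# → ¬ x * y ≈ 0#) where

    private
      -- A product whose first factor has lowest coefficient 0 is y times the
      -- product with that coefficient removed.
      dropZeroHead : ∀ {a u w} → a ≈ 0# → addL (map (a *_) u) (0# ∷ w) ≃ [] → w ≃ []
      dropZeroHead {a} {u} {w} a≈0 v≃0 = coeffwise λ n → begin
        coeff w n                                        ≈⟨ +-identityˡ _ ⟨
        0# + coeff w n                                   ≈⟨ +-congʳ (trans (*-congʳ a≈0) (zeroˡ _)) ⟨
        a * coeff u (suc n) + coeff w n                  ≈⟨ +-congʳ (coeff-scale a u (suc n)) ⟨
        coeff (map (a *_) u) (suc n) + coeff (0# ∷ w) (suc n)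
                                                         ≈⟨ coeff-addL (map (a *_) u) (0# ∷ w) (suc n) ⟨
        coeff (addL (map (a *_) u) (0# ∷ w)) (suc n)     ≈⟨ v≃0 .at (suc n) ⟩
        0#                                               ∎

      zeroHead : ∀ {a p} → a ≈ 0# → p ≃ [] → (a ∷ p) ≃ []
      zeroHead a≈0 p≃0 = coeffwise λ where
        zero    → a≈0
        (suc n) → p≃0 .at n

    mulL-noZeroDivisors-head : ∀ {a} p q → ¬ a ≈ 0# → ¬ q ≃ [] → ¬ mulL (a ∷ p) q ≃ []
    mulL-noZeroDivisors-head     p []      a≉0 q≄0 pq≃0 = q≄0 ≃-refl
    mulL-noZeroDivisors-head {a} p (b ∷ q) a≉0 q≄0 pq≃0 = ¬¬-excluded-middle λ where
      (yes b≈0) → mulL-noZeroDivisors-head p q a≉0 (λ q≃0 → q≄0 (zeroHead b≈0 q≃0))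
                    (dropZeroHead {u = a ∷ p} b≈0 (≃-trans (≃-sym (mulL-consʳ (a ∷ p) b q)) pq≃0))
      (no b≉0)  → noZeroDivisors a≉0 b≉0 (trans (sym (+-identityʳ _)) (pq≃0 .at 0))

    mulL-noZeroDivisors : ∀ p q → ¬ p ≃ [] → ¬ q ≃ [] → ¬ mulL p q ≃ []
    mulL-noZeroDivisors []      q p≄0 q≄0 pq≃0 = p≄0 ≃-refl
    mulL-noZeroDivisors (a ∷ p) q p≄0 q≄0 pq≃0 = ¬¬-excluded-middle λ where
      (yes a≈0) → mulL-noZeroDivisors p q (λ p≃0 → p≄0 (zeroHead a≈0 p≃0)) q≄0
                    (dropZeroHead {u = q} a≈0 pq≃0)
      (no a≉0)  → mulL-noZeroDivisors-head p q a≉0 q≄0 pq≃0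

module CubeAlgebra {c ℓ} (R : CommutativeRing c ℓ) where
  open CommutativeRing R
  open Forms R using (ι)
  open import Algebra.Properties.Ring ring using (+-cancelˡ; +-cancelʳ; //-rightDividesˡ)
  open import Algebra.Solver.Ring.NaturalCoefficients.Default commutativeSemiring
  open import Relation.Binary.Reasoning.Setoid setoid

  -- (x + y)³ = x³ + y³ + 3 x y (x + y); the solver's 1 + (1 + (1 + 0)) is ι 3.
  cube-of-sum : ∀ x y → (x + y) * ((x + y) * (x + y)) ≈
                         (x * (x * x) + y * (y * y)) + ι 3 * ((x * y) * (x + y))
  cube-of-sum = solve 2 (λ x y →
    (x :+ y) :* ((x :+ y) :* (x :+ y)) :=
    (x :* (x :* x) :+ y :* (y :* y)) :+ (con 1 :+ (con 1 :+ (con 1 :+ con 0))) :* ((x :* y) :* (x :+ y)))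
    refl

  -- With a + b = t s, s = c + d and t³ = 1, both a³ + b³ + 3 s (t a b) and
  -- c³ + d³ + 3 s (c d) equal s³; so a³ + b³ = c³ + d³ gives 3 s t a b = 3 s c d.
  cubes⇒products : ∀ {a b c d t} → a + b ≈ t * (c + d) → (t * t) * t ≈ 1# →
                   a * (a * a) + b * (b * b) ≈ c * (c * c) + d * (d * d) →
                   ι 3 * ((c + d) * (t * (a * b))) ≈ ι 3 * ((c + d) * (c * d))
  cubes⇒products {a} {b} {c} {d} {t} sum t³≈1 cubes =
    +-cancelˡ (c * (c * c) + d * (d * d)) _ _ (trans (+-congʳ (sym cubes)) (begin
      a * (a * a) + b * (b * b) + ι 3 * (s * (t * (a * b)))
        ≈⟨ +-congˡ (*-congˡ (reorder s t a b)) ⟩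
      a * (a * a) + b * (b * b) + ι 3 * ((a * b) * (t * s))
        ≈⟨ +-congˡ (*-congˡ (*-congˡ sum)) ⟨
      a * (a * a) + b * (b * b) + ι 3 * ((a * b) * (a + b))
        ≈⟨ cube-of-sum a b ⟨
      (a + b) * ((a + b) * (a + b))
        ≈⟨ *-cong sum (*-cong sum sum) ⟩
      (t * s) * ((t * s) * (t * s))
        ≈⟨ cube-of-product t s ⟩
      ((t * t) * t) * (s * (s * s))
        ≈⟨ trans (*-congʳ t³≈1) (*-identityˡ _) ⟩
      s * (s * s)
        ≈⟨ cube-of-sum c d ⟩
      c * (c * c) + d * (d * d) + ι 3 * ((c * d) * s)
        ≈⟨ +-congˡ (*-congˡ (*-comm _ _)) ⟩
      c * (c * c) + d * (d * d) + ι 3 * (s * (c * d))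
        ∎))
    where
    s : Carrier
    s = c + d
    reorder : ∀ s t a b → s * (t * (a * b)) ≈ (a * b) * (t * s)
    reorder = solve 4 (λ s t a b → s :* (t :* (a :* b)) := (a :* b) :* (t :* s)) refl
    cube-of-product : ∀ t s → (t * s) * ((t * s) * (t * s)) ≈ ((t * t) * t) * (s * (s * s))
    cube-of-product = solve 2 (λ t s →
      (t :* s) :* ((t :* s) :* (t :* s)) := ((t :* t) :* t) :* (s :* (s :* s))) refl

  products⇒root : ∀ {a b c d t} → a + b ≈ t * (c + d) → (t * t) * t ≈ 1# → t * (a * b) ≈ c * d →
                  ((t * t) * a) * ((t * t) * a) + c * d ≈ ((t * t) * a) * (c + d)
  products⇒root {a} {b} {c} {d} {t} sum t³≈1 products = begin
    ((t * t) * a) * ((t * t) * a) + c * d      ≈⟨ +-congˡ products ⟨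
    ((t * t) * a) * ((t * t) * a) + t * (a * b) ≈⟨ +-congʳ (split t a) ⟩
    ((t * t) * t) * (t * (a * a)) + t * (a * b) ≈⟨ +-congʳ (trans (*-congʳ t³≈1) (*-identityˡ _)) ⟩
    t * (a * a) + t * (a * b)                   ≈⟨ factor t a b ⟩
    (t * a) * (a + b)                           ≈⟨ *-congˡ sum ⟩
    (t * a) * (t * (c + d))                     ≈⟨ regroup t a (c + d) ⟩
    ((t * t) * a) * (c + d)                     ∎
    where
    split : ∀ t a → ((t * t) * a) * ((t * t) * a) ≈ ((t * t) * t) * (t * (a * a))
    split = solve 2 (λ t a → ((t :* t) :* a) :* ((t :* t) :* a) := ((t :* t) :* t) :* (t :* (a :* a))) refl
    factor : ∀ t a b → t * (a * a) + t * (a * b) ≈ (t * a) * (a + b)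
    factor = solve 3 (λ t a b → t :* (a :* a) :+ t :* (a :* b) := (t :* a) :* (a :+ b)) refl
    regroup : ∀ t a s → (t * a) * (t * s) ≈ ((t * t) * a) * s
    regroup = solve 3 (λ t a s → (t :* a) :* (t :* s) := ((t :* t) :* a) :* s) refl

  vieta : ∀ {x c d} → x * x + c * d ≈ x * (c + d) → (x - c) * (x - d) ≈ 0#
  vieta {x} {c} {d} root = +-cancelʳ (x * (c + d)) _ _ (begin
    (x - c) * (x - d) + x * (c + d)
      ≈⟨ +-congˡ (distribˡ x c d) ⟩
    (x - c) * (x - d) + (x * c + x * d)
      ≈⟨ +-congˡ (+-cong (*-congʳ (//-rightDividesˡ d x)) (*-congʳ (//-rightDividesˡ c x))) ⟨
    (x - c) * (x - d) + (((x - d) + d) * c + ((x - c) + c) * d)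
      ≈⟨ expand (x - c) (x - d) c d ⟩
    ((x - c) + c) * ((x - d) + d) + c * d
      ≈⟨ +-congʳ (*-cong (//-rightDividesˡ c x) (//-rightDividesˡ d x)) ⟩
    x * x + c * d
      ≈⟨ root ⟩
    x * (c + d)
      ≈⟨ +-identityˡ _ ⟨
    0# + x * (c + d)
      ∎)
    where
    expand : ∀ y z c d → y * z + ((z + d) * c + (y + c) * d) ≈ (y + c) * (z + d) + c * d
    expand = solve 4 (λ y z c d →
      y :* z :+ ((z :+ d) :* c :+ (y :+ c) :* d) := (y :+ c) :* (z :+ d) :+ c :* d) refl

module QuadraticForms {c ℓ} (R : CommutativeRing c ℓ) where
  open CommutativeRing R
  open Forms R
  open Polynomials R
  open import Algebra.Properties.Ring ring using (-‿involutive; -‿distribˡ-*)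

  Multiple : QForm → QForm → Set (c ⊔ ℓ)
  Multiple f g = ∃[ λ₀ ] f ≐ (λ₀ · g)

  multiple-⊝ : ∀ {f g} → Multiple (⊝ f) g → Multiple f g
  multiple-⊝ {qf a b c′} {qf a′ b′ c″} (λ₀ , -a≈ , -b≈ , -c≈) =
    - λ₀ , unnegate -a≈ , unnegate -b≈ , unnegate -c≈
    where
    unnegate : ∀ {x y} → - x ≈ λ₀ * y → x ≈ (- λ₀) * y
    unnegate {x} {y} -x≈λy =
      trans (sym (-‿involutive x)) (trans (-‿cong -x≈λy) (-‿distribˡ-* λ₀ y))

  Pointwise⇒≃ : ∀ {p q} → Pointwise _≈_ p q → p ≃ q
  Pointwise⇒≃ []              = ≃-refl
  Pointwise⇒≃ (x≈y ∷ xs≈ys)   = ∷-cong x≈y (Pointwise⇒≃ xs≈ys)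

  ≐⇒≃ : ∀ {f g} → f ≐ g → coeffs f ≃ coeffs g
  ≐⇒≃ {qf a b c′} {qf a′ b′ c″} (a≈ , b≈ , c≈) = ∷-cong a≈ (∷-cong b≈ (∷-cong c≈ ≃-refl))

  coeffs-· : ∀ λ₀ g → coeffs (λ₀ · g) ≃ mulL (const λ₀) (coeffs g)
  coeffs-· λ₀ g@(qf a b c′) = coeffwise λ n →
    trans (coeff-scale λ₀ (coeffs g) n) (sym (coeff-constMul λ₀ (coeffs g) n))

  ≃⇒multiple : ∀ {f g λ₀} → coeffs f ≃ mulL (const λ₀) (coeffs g) → Multiple f g
  ≃⇒multiple {qf a b c′} {g} {λ₀} f≃λg = λ₀ , coefficient 0 , coefficient 1 , coefficient 2
    where
    coefficient : ∀ n → coeff (coeffs (qf a b c′)) n ≈ λ₀ * coeff (coeffs g) n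
    coefficient n = trans (f≃λg .at n) (coeff-constMul λ₀ (coeffs g) n)

-- The argument over an algebraically closed field K of characteristic 0;
-- only the field axioms and 3 ≠ 0 are used.
module TypeT {c ℓ} (K : ACField0 c ℓ) where
  open ACField0 K using (cring; inverse; char0)
  open CommutativeRing cring
  open Forms cring
  open Polynomials cring
  open QuadraticForms cring
  open import Relation.Binary.Reasoning.Setoid setoid
  import Algebra.Properties.Ring as RingProperties

  *-cancelˡ : ∀ {a x y} → ¬ a ≈ 0# → a * x ≈ a * y → x ≈ y
  *-cancelˡ {a} {x} {y} a≉0 ax≈ay with inverse a a≉0
  ... | a⁻¹ , aa⁻¹≈1 = trans (sym (undo x)) (trans (*-congˡ ax≈ay) (undo y))
    where
    undo : ∀ z → a⁻¹ * (a * z) ≈ z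
    undo z = begin
      a⁻¹ * (a * z)  ≈⟨ *-assoc a⁻¹ a z ⟨
      (a⁻¹ * a) * z  ≈⟨ *-congʳ (trans (*-comm a⁻¹ a) aa⁻¹≈1) ⟩
      1# * z         ≈⟨ *-identityˡ z ⟩
      z              ∎

  noZeroDivisors : ∀ {x y} → ¬ x ≈ 0# → ¬ y ≈ 0# → ¬ x * y ≈ 0#
  noZeroDivisors x≉0 y≉0 xy≈0 = y≉0 (*-cancelˡ x≉0 (trans xy≈0 (sym (zeroʳ _))))

  module P = CommutativeRing polyRing
  module RR = RingProperties ring
  module PR = RingProperties P.ring
  module PC = CubeAlgebra polyRing
  open CommutativeRing polyRing using ()
    renaming (_+_ to _⊞_; _*_ to _⊠_; _-_ to _⊟_; 0# to 0ₚ; 1# to 1ₚ)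
  open NoZeroDivisors noZeroDivisors

  sum≃0⇒multiple : ∀ {g f} → coeffs g ⊞ coeffs f ≃ 0ₚ → Multiple f g
  sum≃0⇒multiple {g} {f} g+f≃0 =
    ≃⇒multiple (≃-trans (PR.+-inverseʳ-unique (coeffs g) (coeffs f) g+f≃0)
                        (≃-sym (PR.-1*x≈-x (coeffs g))))

  typeCond⇒T[T³-1]≉0 : ∀ T h₁ h₂ h₃ h₄ →
    ¬ Multiple h₂ h₁ → ¬ Multiple h₃ h₄ → ¬ Multiple h₃ h₁ → ¬ Multiple h₄ h₁ →
    TypeCond T h₁ h₂ h₃ h₄ → ¬ T * (T * T * T - 1#) ≈ 0#
  typeCond⇒T[T³-1]≉0 T h₁ h₂ h₃ h₄ ¬h₂∝h₁ ¬h₃∝h₄ ¬h₃∝h₁ ¬h₄∝h₁ (cubes , sum) T[T³-1]≈0 =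
    -- T = 0 gives h₁ + h₂ = 0; otherwise T³ = 1 and s (T h₁ h₂ - h₃ h₄) = 0.
    ¬¬-excluded-middle λ where
      (yes T≈0) → ¬h₂∝h₁ (sum≃0⇒multiple
                    (≃-trans sumₚ (≃-trans (P.*-congʳ {S} (τ≃0 T≈0)) (P.zeroˡ S))))
      (no T≉0)  → let open CubeRootOfUnity T≉0 in mulL-noZeroDivisors S V S≄0 V≄0 S⊠V≃0
    where
    H₁ H₂ H₃ H₄ S τ : List Carrier
    H₁ = coeffs h₁
    H₂ = coeffs h₂
    H₃ = coeffs h₃
    H₄ = coeffs h₄
    S  = H₃ ⊞ H₄
    τ  = const T

    sumₚ : H₁ ⊞ H₂ ≃ τ ⊠ S
    sumₚ = ≃-trans (≐⇒≃ sum) (coeffs-· T (h₃ ⊕ h₄))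

    τ≃0 : T ≈ 0# → τ ≃ 0ₚ
    τ≃0 T≈0 = ≃-trans (const-cong T≈0) 0∷[]≃[]

    -- s = 0 would make h₃ = -h₄.
    S≄0 : ¬ S ≃ 0ₚ
    S≄0 S≃0 = ¬h₃∝h₄ (sum≃0⇒multiple (≃-trans (addL-comm H₄ H₃) S≃0))

    module CubeRootOfUnity (T≉0 : ¬ T ≈ 0#) where
      T³≈1 : T * T * T ≈ 1#
      T³≈1 = RR.x∙y⁻¹≈ε⇒x≈y _ _ (*-cancelˡ T≉0 (trans T[T³-1]≈0 (sym (zeroʳ T))))

      τ³≃1 : τ ⊠ τ ⊠ τ ≃ 1ₚ
      τ³≃1 = ≃-trans (mulL-cong (≃-sym (const-* T T)) (≃-refl {τ}))
                     (≃-trans (≃-sym (const-* (T * T) T)) (const-cong T³≈1))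

      products : S ⊠ (τ ⊠ (H₁ ⊠ H₂)) ≃ S ⊠ (H₃ ⊠ H₄)
      products = constMul-cancel (*-cancelˡ (char0 2))
        (≃-trans (mulL-cong (≃-sym (ι-const 3)) (≃-refl {S ⊠ (τ ⊠ (H₁ ⊠ H₂))}))
          (≃-trans (PC.cubes⇒products {H₁} {H₂} {H₃} {H₄} {τ} sumₚ τ³≃1 (Pointwise⇒≃ cubes))
                   (mulL-cong (ι-const 3) (≃-refl {S ⊠ (H₃ ⊠ H₄)}))))

      V : List Carrier
      V = τ ⊠ (H₁ ⊠ H₂) ⊟ H₃ ⊠ H₄

      S⊠V≃0 : S ⊠ V ≃ 0ₚ
      S⊠V≃0 = ≃-trans (PR.x[y-z]≈xy-xz S (τ ⊠ (H₁ ⊠ H₂)) (H₃ ⊠ H₄))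
                      (PR.x≈y⇒x∙y⁻¹≈ε {S ⊠ (τ ⊠ (H₁ ⊠ H₂))} {S ⊠ (H₃ ⊠ H₄)} products)

      X : List Carrier
      X = τ ⊠ τ ⊠ H₁

      X≄h : ∀ {h} → ¬ Multiple h h₁ → ¬ X ⊟ coeffs h ≃ 0ₚ
      X≄h {h} ¬h∝h₁ X-h≃0 = ¬h∝h₁ (≃⇒multiple
        (≃-trans (≃-sym (PR.x∙y⁻¹≈ε⇒x≈y X (coeffs h) X-h≃0))
                 (mulL-cong (≃-sym (const-* T T)) (≃-refl {H₁}))))

      V≄0 : ¬ V ≃ 0ₚ
      V≄0 V≃0 = mulL-noZeroDivisors (X ⊟ H₃) (X ⊟ H₄) (X≄h ¬h₃∝h₁) (X≄h ¬h₄∝h₁)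
        (PC.vieta {X} {H₃} {H₄}
          (PC.products⇒root {H₁} {H₂} {H₃} {H₄} {τ} sumₚ τ³≃1
            (PR.x∙y⁻¹≈ε⇒x≈y (τ ⊠ (H₁ ⊠ H₂)) (H₃ ⊠ H₄) V≃0)))

-- Each of the three readings of Type(T) is an instance of the argument in TypeT;
-- for the flips, negating a form does not affect proportionality.
lemma4p2 : ∀ {c ℓ} (K : ACField0 c ℓ) →
    let R = ACField0.cring K
        open CommutativeRing R
        open Forms R
    in ∀ (f₁ f₂ f₃ f₄ : QForm) (T : Carrier) →
       PairwiseNonProp f₁ f₂ f₃ f₄ →
       CubeId f₁ f₂ f₃ f₄ →
       IsOfType T f₁ f₂ f₃ f₄ →
       ¬ (T * (T * T * T - 1#) ≈ 0#)
lemma4p2 K f₁ f₂ f₃ f₄ T (¬f₁∥f₂ , ¬f₁∥f₃ , ¬f₁∥f₄ , ¬f₂∥f₃ , ¬f₂∥f₄ , ¬f₃∥f₄) _ = λ where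
    (inj₁ original) →
      typeCond⇒T[T³-1]≉0 T f₁ f₂ f₃ f₄
        (¬f₁∥f₂ ∘ inj₂) (¬f₃∥f₄ ∘ inj₁) (¬f₁∥f₃ ∘ inj₂) (¬f₁∥f₄ ∘ inj₂) original
    (inj₂ (inj₁ firstFlip)) →
      typeCond⇒T[T³-1]≉0 T f₁ (⊝ f₃) (⊝ f₂) f₄
        (¬f₁∥f₃ ∘ inj₂ ∘ multiple-⊝) (¬f₂∥f₄ ∘ inj₁ ∘ multiple-⊝)
        (¬f₁∥f₂ ∘ inj₂ ∘ multiple-⊝) (¬f₁∥f₄ ∘ inj₂) firstFlip
    (inj₂ (inj₂ secondFlip)) →
      typeCond⇒T[T³-1]≉0 T f₁ (⊝ f₄) (⊝ f₂) f₃
        (¬f₁∥f₄ ∘ inj₂ ∘ multiple-⊝) (¬f₂∥f₃ ∘ inj₁ ∘ multiple-⊝)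
        (¬f₁∥f₂ ∘ inj₂ ∘ multiple-⊝) (¬f₁∥f₃ ∘ inj₂) secondFlip
  where
  open Forms (ACField0.cring K) using (⊝_)
  open QuadraticForms (ACField0.cring K) using (multiple-⊝)
  open TypeT K using (typeCond⇒T[T³-1]≉0)
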